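{- There exists $\alpha>0$ such that the following holds. Suppose $n,W\in\mathbb{N}$ are large enough and $\omega_1,\ldots,\omega_t\colon[n]\to[W]$ are weight assignments with $t\le\alpha\cdot\frac{n}{\log(nW)}$. Then there exists a graph $G$ on vertex set $[n]$ such that the treedepth of $G$ is at most $4$, and $G$ has exactly two different maximum-size independent sets $A$ and $B$, which moreover satisfy $\omega_i(A)=\omega_i(B)$ for all $i\in[t]$.
   Context: $[k]=\{1,\ldots,k\}$; for $\omega\colon[n]\to[W]$ and $X\subseteq[n]$, $\omega(X)=\sum_{x\in X}\omega(x)$. The treedepth of a graph $G$ is the minimum height (maximum number of vertices on a root-to-leaf path) of a rooted forest $F$ with $V(F)=V(G)$ such that for every edge $uv$ of $G$, $u$ is an ancestor of $v$ in $F$ or vice versa. -}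

module Defs where

open import Data.Nat using (ℕ; _+_; _≤_)
open import Data.Sum using (_⊎_)
import Data.Nat
open import Data.Fin using (Fin; zero; suc)
open import Data.Fin.Subset using (Subset; _∈_; ∣_∣; inside; outside)
open import Data.Vec using (Vec; []; _∷_)
open import Data.Maybe using (Maybe; just; nothing)
open import Data.Product using (Σ; _×_)
open import Relation.Binary.PropositionalEquality using (_≡_)
open import Relation.Nullary using (¬_)

record Graph (n : ℕ) : Set₁ where
  field
    Adj     : Fin n → Fin n → Set
    symm    : ∀ {u v} → Adj u v → Adj v u
    irrefl  : ∀ {u} → ¬ Adj u u
open Graph public

record RootedForest (n : ℕ) : Set where
  field
    parent : Fin n → Maybe (Fin n)
    depth  : Fin n → ℕ
    depth-root   : ∀ v → parent v ≡ nothing → depth v ≡ 1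
    depth-parent : ∀ v u → parent v ≡ just u → depth v ≡ Data.Nat.suc (depth u)
open RootedForest public

data Ancestor {n : ℕ} (F : RootedForest n) : Fin n → Fin n → Set where
  anc-parent : ∀ {u v} → parent F v ≡ just u → Ancestor F u v
  anc-step   : ∀ {u w v} → parent F v ≡ just w → Ancestor F u w → Ancestor F u v

-- height = max number of vertices on a root-to-leaf path = max depth
HeightAtMost : {n : ℕ} → RootedForest n → ℕ → Set
HeightAtMost F k = ∀ v → depth F v ≤ k

TreedepthAtMost : {n : ℕ} → Graph n → ℕ → Set
TreedepthAtMost {n} G k =
  Σ (RootedForest n) λ F → HeightAtMost F k ×
    (∀ u v → Adj G u v → (Ancestor F u v ⊎ Ancestor F v u))

Independent : {n : ℕ} → Graph n → Subset n → Set
Independent G A = ∀ u v → u ∈ A → v ∈ A → ¬ Adj G u v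

MaximumIndependent : {n : ℕ} → Graph n → Subset n → Set
MaximumIndependent G A =
  Independent G A × (∀ C → Independent G C → ∣ C ∣ ≤ ∣ A ∣)

weight : {n : ℕ} → (Fin n → ℕ) → Subset n → ℕ
weight ω []            = 0
weight ω (inside  ∷ X) = ω zero + weight (λ i → ω (suc i)) X
weight ω (outside ∷ X) = weight (λ i → ω (suc i)) X

WeightAssignment : ℕ → ℕ → Set
WeightAssignment n W = Σ (Fin n → ℕ) λ ω → ∀ x → 1 ≤ ω x × ω x ≤ W

-- Split the vertices into k = ⌊n/2⌋ pairs and the remaining ones. Choosing one vertex of
-- every pair gives 2^k selections, while the t weights of a selection take at most
-- (kW + 1)^t < 2^k values, so two selections s ≠ s′ are indistinguishable by every ω_i.
-- On a pair j where they differ let x_j be the vertex chosen by s and y_j the one chosen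
-- by s′, and fix such a pair j₀. Join x_j to y_j, x_{j₀} to every y_j and every x_j to
-- y_{j₀}; all other vertices are isolated. An independent set contains at most one of
-- x_j, y_j, so a maximum one contains exactly one of them and all isolated vertices, and
-- the edges at j₀ force it to take all the x's or all the y's. These two sets differ by
-- trading the choices of s for those of s′, hence have equal weights, and the forest
-- x_{j₀} – y_{j₀} – x_j – y_j witnesses treedepth at most 4.

module Submission where

open import Defs
open import Data.Nat using (ℕ; zero; suc; _+_; _*_; _∸_; _^_; _≤_; _<_; z≤n; s≤s; z<s; ⌊_/2⌋; ⌈_/2⌉)
open import Data.Nat.Properties
open import Data.Nat.Logarithm using (⌈log₂_⌉; ⌈log₂⌉-mono-≤; ⌈log₂2^n⌉≡n)
open import Data.Nat.Logarithm.Core using (⌈log2⌉)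
open import Data.Nat.Tactic.RingSolver using (solve-∀)
open import Algebra.Properties.CommutativeMonoid.Sum +-0-commutativeMonoid
  using (sum; sum-cong-≗; ∑-distrib-+)
open import Algebra.Properties.CommutativeSemigroup +-commutativeSemigroup
  using (xy∙z≈xz∙y)
open import Data.Bool using (Bool; true; false; not; if_then_else_; _xor_)
open import Data.Bool.Properties using (¬-not; not-injective) renaming (_≟_ to _≟ᵇ_)
open import Data.Fin using (Fin; zero; suc; _↑ˡ_; _↑ʳ_; splitAt; toℕ; fromℕ<; finToFun; funToFin; combine)
open import Data.Fin.Properties
  using (splitAt-↑ˡ; splitAt-↑ʳ; splitAt⁻¹-↑ˡ; splitAt⁻¹-↑ʳ; pigeonhole; ¬∀⟶∃¬;
         funToFin-finToFin; finToFun-funToFin; toℕ-fromℕ<; 2↔Bool)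
  renaming (_≟_ to _≟ᶠ_; <-irrefl to <ᶠ-irrefl)
open import Data.Fin.Subset using (Subset; _∈_; ∣_∣)
open import Data.Vec using ([]; _∷_; lookup; tabulate)
open import Data.Vec.Properties using ([]=⇒lookup; lookup⇒[]=; lookup∘tabulate; tabulate∘lookup; tabulate-cong)
open import Data.Maybe using (Maybe; just; nothing)
open import Data.Product using (Σ; ∃; _×_; _,_; proj₁; proj₂)
open import Data.Sum using (_⊎_; inj₁; inj₂; [_,_]′; swap) renaming (map to ⊎-map)
open import Data.Empty using (⊥; ⊥-elim)
open import Function using (_∘_; Inverse)
open import Induction.WellFounded using (Acc; acc)
open import Relation.Binary.PropositionalEquality
open import Relation.Nullary using (¬_; yes; no)

private
  variable
    m n k t W : ℕ

-- Finite sums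

sum-↑ : ∀ m (f : Fin (m + n) → ℕ) → sum f ≡ sum (f ∘ (_↑ˡ n)) + sum (f ∘ (m ↑ʳ_))
sum-↑ zero    f = refl
sum-↑ (suc m) f = trans (cong (f zero +_) (sum-↑ m (f ∘ suc))) (sym (+-assoc (f zero) _ _))

sum-mono-≤ : {f g : Fin n → ℕ} → (∀ i → f i ≤ g i) → sum f ≤ sum g
sum-mono-≤ {zero}  f≤g = z≤n
sum-mono-≤ {suc n} f≤g = +-mono-≤ (f≤g zero) (sum-mono-≤ (f≤g ∘ suc))

sum-≤-* : {f : Fin n → ℕ} → (∀ i → f i ≤ W) → sum f ≤ n * W
sum-≤-* {zero}  f≤W = z≤n
sum-≤-* {suc n} f≤W = +-mono-≤ (f≤W zero) (sum-≤-* (f≤W ∘ suc))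

+-tight : ∀ {a b c d} → a ≤ b → c ≤ d → b + d ≤ a + c → a ≡ b × c ≡ d
+-tight {a} {b} {c} {d} a≤b c≤d b+d≤a+c =
    ≤-antisym a≤b (+-cancelʳ-≤ d b a (≤-trans b+d≤a+c (+-monoʳ-≤ a c≤d)))
  , ≤-antisym c≤d (+-cancelˡ-≤ b d c (≤-trans b+d≤a+c (+-monoˡ-≤ c a≤b)))

sum-tight : {f g : Fin n → ℕ} → (∀ i → f i ≤ g i) → sum g ≤ sum f → ∀ i → f i ≡ g i
sum-tight {suc n} f≤g g≤f with +-tight (f≤g zero) (sum-mono-≤ (f≤g ∘ suc)) g≤f
... | head≡ , tail≡ = λ where
  zero    → head≡
  (suc i) → sum-tight (f≤g ∘ suc) (≤-reflexive (sym tail≡)) i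

𝟙 : Bool → ℕ
𝟙 b = if b then 1 else 0

𝟙≤1 : ∀ p → 𝟙 p ≤ 1
𝟙≤1 true  = ≤-refl
𝟙≤1 false = z≤n

𝟙+𝟙≤1 : ∀ p q → (p ≡ true → q ≡ true → ⊥) → 𝟙 p + 𝟙 q ≤ 1
𝟙+𝟙≤1 true  true  ¬both = ⊥-elim (¬both refl refl)
𝟙+𝟙≤1 true  false _     = ≤-refl
𝟙+𝟙≤1 false q     _     = 𝟙≤1 q

𝟙+𝟙≡2 : ∀ p q → 𝟙 p + 𝟙 q ≡ 2 → p ≡ true × q ≡ true
𝟙+𝟙≡2 true  true  _ = refl , refl
𝟙+𝟙≡2 true  false ()
𝟙+𝟙≡2 false true  ()
𝟙+𝟙≡2 false false ()

𝟙+𝟙≡1 : ∀ p q → 𝟙 p + 𝟙 q ≡ 1 → p ≡ not q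
𝟙+𝟙≡1 true  false _ = refl
𝟙+𝟙≡1 false true  _ = refl
𝟙+𝟙≡1 true  true  ()
𝟙+𝟙≡1 false false ()

𝟙≡1 : ∀ p → 𝟙 p ≡ 1 → p ≡ true
𝟙≡1 true _ = refl

mask : (Fin n → ℕ) → (Fin n → Bool) → Fin n → ℕ
mask ω c v = if c v then ω v else 0

weightᵇ : (Fin n → ℕ) → (Fin n → Bool) → ℕ
weightᵇ ω c = sum (mask ω c)

∣_∣ᵇ : (Fin n → Bool) → ℕ
∣ c ∣ᵇ = weightᵇ (λ _ → 1) c

weightᵇ-cong : ∀ (ω : Fin n → ℕ) {c d} → (∀ v → c v ≡ d v) → weightᵇ ω c ≡ weightᵇ ω d
weightᵇ-cong ω c≗d = sum-cong-≗ λ v → cong (if_then ω v else 0) (c≗d v)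

weight≡weightᵇ : ∀ (ω : Fin n → ℕ) C → weight ω C ≡ weightᵇ ω (lookup C)
weight≡weightᵇ ω []          = refl
weight≡weightᵇ ω (true  ∷ C) = cong (ω zero +_) (weight≡weightᵇ (ω ∘ suc) C)
weight≡weightᵇ ω (false ∷ C) = weight≡weightᵇ (ω ∘ suc) C

∣∣≡∣lookup∣ᵇ : (C : Subset n) → ∣ C ∣ ≡ ∣ lookup C ∣ᵇ
∣∣≡∣lookup∣ᵇ []          = refl
∣∣≡∣lookup∣ᵇ (true  ∷ C) = cong suc (∣∣≡∣lookup∣ᵇ C)
∣∣≡∣lookup∣ᵇ (false ∷ C) = ∣∣≡∣lookup∣ᵇ C

weight-tabulate : ∀ (ω : Fin n → ℕ) c → weight ω (tabulate c) ≡ weightᵇ ω c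
weight-tabulate ω c = trans (weight≡weightᵇ ω (tabulate c)) (weightᵇ-cong ω (lookup∘tabulate c))

∣tabulate∣ : ∀ (c : Fin n → Bool) → ∣ tabulate c ∣ ≡ ∣ c ∣ᵇ
∣tabulate∣ c = trans (∣∣≡∣lookup∣ᵇ (tabulate c)) (weightᵇ-cong (λ _ → 1) (lookup∘tabulate c))

Independentᵇ : Graph n → (Fin n → Bool) → Set
Independentᵇ G c = ∀ u v → c u ≡ true → c v ≡ true → ¬ Adj G u v

independent-lookup : ∀ {G : Graph n} {C} → Independent G C → Independentᵇ G (lookup C)
independent-lookup {C = C} ind u v u∈C v∈C = ind u v (lookup⇒[]= u C u∈C) (lookup⇒[]= v C v∈C)

maximum-tabulate : ∀ {G : Graph n} {c} → Independentᵇ G c →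
                   (∀ d → Independentᵇ G d → ∣ d ∣ᵇ ≤ ∣ c ∣ᵇ) → MaximumIndependent G (tabulate c)
maximum-tabulate {G = G} {c} ind max = independent , λ C indC → begin
    ∣ C ∣            ≡⟨ ∣∣≡∣lookup∣ᵇ C ⟩
    ∣ lookup C ∣ᵇ    ≤⟨ max (lookup C) (independent-lookup {G = G} {C} indC) ⟩
    ∣ c ∣ᵇ           ≡⟨ ∣tabulate∣ c ⟨
    ∣ tabulate c ∣   ∎
  where
  open ≤-Reasoning
  lookup-c : ∀ {v} → v ∈ tabulate c → c v ≡ true
  lookup-c {v} v∈ = trans (sym (lookup∘tabulate c v)) ([]=⇒lookup v∈)
  independent : Independent G (tabulate c)
  independent u v u∈ v∈ = ind u v (lookup-c u∈) (lookup-c v∈)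

≗-tabulate : ∀ {C : Subset n} {c} → (∀ v → lookup C v ≡ c v) → C ≡ tabulate c
≗-tabulate {C = C} C≗c = trans (sym (tabulate∘lookup C)) (tabulate-cong C≗c)

EqualWeightTwins : (Fin t → Fin n → ℕ) → Set₁
EqualWeightTwins {n = n} ω =
  Σ (Graph n) λ G → TreedepthAtMost G 4 ×
    Σ (Subset n) λ A → Σ (Subset n) λ B →
      A ≢ B × MaximumIndependent G A × MaximumIndependent G B ×
      (∀ C → MaximumIndependent G C → C ≡ A ⊎ C ≡ B) ×
      (∀ i → weight (ω i) A ≡ weight (ω i) B)

-- Two selections with equal weight sums

funToFin-cong : {f g : Fin m → Fin n} → (∀ i → f i ≡ g i) → funToFin f ≡ funToFin g
funToFin-cong {zero}  f≗g = refl
funToFin-cong {suc m} f≗g = cong₂ combine (f≗g zero) (funToFin-cong (f≗g ∘ suc))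

selector : Fin (2 ^ k) → Fin k → Bool
selector i j = Inverse.to 2↔Bool (finToFun i j)

selector-injective : ∀ {k} (i i′ : Fin (2 ^ k)) → (∀ j → selector {k} i j ≡ selector i′ j) → i ≡ i′
selector-injective {k} i i′ same = begin
  i                               ≡⟨ funToFin-finToFin {k} {2} i ⟨
  funToFin (finToFun {2} {k} i)   ≡⟨ funToFin-cong (λ j → begin
      finToFun i j                    ≡⟨ strictlyInverseʳ (finToFun {2} {k} i j) ⟨
      from (selector {k} i j)         ≡⟨ cong from (same j) ⟩
      from (selector {k} i′ j)        ≡⟨ strictlyInverseʳ (finToFun {2} {k} i′ j) ⟩
      finToFun i′ j                   ∎) ⟩
  funToFin (finToFun {2} {k} i′)  ≡⟨ funToFin-finToFin {k} {2} i′ ⟩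
  i′                              ∎
  where
  open ≡-Reasoning
  open Inverse 2↔Bool using (from; strictlyInverseʳ)

selector-collision : (f : (Fin k → Bool) → Fin m) → m < 2 ^ k →
                     Σ (Fin k → Bool) λ s → Σ (Fin k → Bool) λ s′ →
                       (∃ λ j → s j ≢ s′ j) × f s ≡ f s′
selector-collision {k} f m<2^k with pigeonhole m<2^k (f ∘ selector)
... | i , i′ , i<i′ , fi≡fi′ =
  selector i , selector i′ ,
  ¬∀⟶∃¬ k _ (λ j → selector i j ≟ᵇ selector i′ j)
             (λ same → <ᶠ-irrefl (selector-injective {k} i i′ same) i<i′) ,
  fi≡fi′

encode : ∀ {M} (f : Fin t → ℕ) → (∀ i → f i ≤ M) → Fin (suc M ^ t)
encode f f≤M = funToFin λ i → fromℕ< (s≤s (f≤M i))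

decode-encode : ∀ {M} (f : Fin t → ℕ) (f≤M : ∀ i → f i ≤ M) i → toℕ (finToFun (encode f f≤M) i) ≡ f i
decode-encode f f≤M i = trans (cong toℕ (finToFun-funToFin _ i)) (toℕ-fromℕ< _)

selectors-with-equal-sums : ∀ {M} (g : (Fin k → Bool) → Fin t → ℕ) → (∀ s i → g s i ≤ M) → suc M ^ t < 2 ^ k →
                            Σ (Fin k → Bool) λ s → Σ (Fin k → Bool) λ s′ →
                              (∃ λ j → s j ≢ s′ j) × (∀ i → g s i ≡ g s′ i)
selectors-with-equal-sums g g≤M room with selector-collision (λ s → encode (g s) (g≤M s)) room
... | s , s′ , differ , same-code = s , s′ , differ , λ i → begin
  g s i                                   ≡⟨ decode-encode (g s) (g≤M s) i ⟨
  toℕ (finToFun (encode (g s) (g≤M s)) i)   ≡⟨ cong (λ c → toℕ (finToFun c i)) same-code ⟩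
  toℕ (finToFun (encode (g s′) (g≤M s′)) i) ≡⟨ decode-encode (g s′) (g≤M s′) i ⟩
  g s′ i                                  ∎
  where open ≡-Reasoning

-- Counting weight profiles

2+[m+m]≡2*[1+m] : ∀ m → 2 + (m + m) ≡ 2 * suc m
2+[m+m]≡2*[1+m] = solve-∀

n≤2^⌈log₂n⌉ : ∀ n → n ≤ 2 ^ ⌈log₂ n ⌉
n≤2^⌈log₂n⌉ n = go n _
  where
  go : ∀ n (rec : Acc _<_ n) → n ≤ 2 ^ ⌈log2⌉ n rec
  go zero          _        = z≤n
  go (suc zero)    _        = s≤s z≤n
  go (suc (suc m)) (acc rs) = begin
    2 + m                            ≡⟨ cong (2 +_) (⌊n/2⌋+⌈n/2⌉≡n m) ⟨
    2 + (⌊ m /2⌋ + ⌈ m /2⌉)          ≤⟨ +-monoʳ-≤ 2 (+-monoˡ-≤ ⌈ m /2⌉ (⌊n/2⌋≤⌈n/2⌉ m)) ⟩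
    2 + (⌈ m /2⌉ + ⌈ m /2⌉)          ≡⟨ 2+[m+m]≡2*[1+m] ⌈ m /2⌉ ⟩
    2 * suc ⌈ m /2⌉                  ≤⟨ *-monoʳ-≤ 2 (go (suc ⌈ m /2⌉) (rs _)) ⟩
    2 * 2 ^ ⌈log2⌉ (suc ⌈ m /2⌉) _   ∎
    where open ≤-Reasoning

⌊n/2⌋+⌊n/2⌋≤n : ∀ n → ⌊ n /2⌋ + ⌊ n /2⌋ ≤ n
⌊n/2⌋+⌊n/2⌋≤n n = ≤-trans (+-monoʳ-≤ ⌊ n /2⌋ (⌊n/2⌋≤⌈n/2⌉ n)) (≤-reflexive (⌊n/2⌋+⌈n/2⌉≡n n))

1+m≤2*m : ∀ {m} → 1 ≤ m → suc m ≤ 2 * m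
1+m≤2*m {m} 1≤m = begin
  1 + m         ≤⟨ +-monoˡ-≤ m 1≤m ⟩
  m + m         ≡⟨ cong (m +_) (+-identityʳ m) ⟨
  2 * m         ∎
  where open ≤-Reasoning

m+m≤n⇒m<n : ∀ {m n} → 1 ≤ n → m + m ≤ n → m < n
m+m≤n⇒m<n {zero}  1≤n _     = 1≤n
m+m≤n⇒m<n {suc m} _   m+m≤n = <-≤-trans (m<m+n (suc m) z<s) m+m≤n

8tL≡4[[L+L]t] : ∀ t L → 8 * t * L ≡ ((L + L) * t + (L + L) * t) + ((L + L) * t + (L + L) * t)
8tL≡4[[L+L]t] = solve-∀

weight-profiles<2^⌊n/2⌋ : 2 ≤ n → 2 ≤ W → 8 * t * ⌈log₂ (n * W) ⌉ ≤ 1 * n →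
                          suc (⌊ n /2⌋ * W) ^ t < 2 ^ ⌊ n /2⌋
weight-profiles<2^⌊n/2⌋ {n} {W} {t} 2≤n 2≤W small = begin-strict
  suc (⌊ n /2⌋ * W) ^ t    ≤⟨ ^-monoˡ-≤ t profile-bound ⟩
  (2 ^ (L + L)) ^ t        ≡⟨ ^-*-assoc 2 (L + L) t ⟩
  2 ^ x                    <⟨ ^-monoʳ-< 2 (s≤s (s≤s z≤n)) x<k ⟩
  2 ^ ⌊ n /2⌋              ∎
  where
  open ≤-Reasoning
  L = ⌈log₂ (n * W) ⌉
  x = (L + L) * t
  1≤L : 1 ≤ L
  1≤L = subst (_≤ L) (⌈log₂2^n⌉≡n 1) (⌈log₂⌉-mono-≤ (*-mono-≤ 2≤n (≤-trans (s≤s z≤n) 2≤W)))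
  profile-bound : suc (⌊ n /2⌋ * W) ≤ 2 ^ (L + L)
  profile-bound = begin
    suc (⌊ n /2⌋ * W)      ≤⟨ s≤s (*-monoˡ-≤ W (⌊n/2⌋≤n n)) ⟩
    suc (n * W)            ≤⟨ s≤s (n≤2^⌈log₂n⌉ (n * W)) ⟩
    suc (2 ^ L)            ≤⟨ 1+m≤2*m (m^n>0 2 L) ⟩
    2 ^ suc L              ≤⟨ ^-monoʳ-≤ 2 (+-monoˡ-≤ L 1≤L) ⟩
    2 ^ (L + L)            ∎
  x<k : x < ⌊ n /2⌋
  x<k = m+m≤n⇒m<n (⌊n/2⌋-mono 2≤n) (begin
    x + x                              ≡⟨ n≡⌊n+n/2⌋ (x + x) ⟩
    ⌊ (x + x) + (x + x) /2⌋            ≡⟨ cong ⌊_/2⌋ (8tL≡4[[L+L]t] t L) ⟨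
    ⌊ 8 * t * L /2⌋                    ≤⟨ ⌊n/2⌋-mono (≤-trans small (≤-reflexive (*-identityˡ n))) ⟩
    ⌊ n /2⌋                            ∎)

-- The graph

module PairedVertices (k r : ℕ) where

  Vertex : Set
  Vertex = Fin (k + (k + r))

  data Slot : Set where
    pair  : Bool → Fin k → Slot
    extra : Fin r → Slot

  vertex : Slot → Vertex
  vertex (pair true  j) = j ↑ˡ (k + r)
  vertex (pair false j) = k ↑ʳ (j ↑ˡ r)
  vertex (extra e)      = k ↑ʳ (k ↑ʳ e)

  slot : Vertex → Slot
  slot v = [ pair true , [ pair false , extra ]′ ∘ splitAt k ]′ (splitAt k v)

  slot-vertex : ∀ x → slot (vertex x) ≡ x
  slot-vertex (pair true  j) rewrite splitAt-↑ˡ k j (k + r) = refl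
  slot-vertex (pair false j) rewrite splitAt-↑ʳ k (k + r) (j ↑ˡ r) | splitAt-↑ˡ k j r = refl
  slot-vertex (extra e)      rewrite splitAt-↑ʳ k (k + r) (k ↑ʳ e) | splitAt-↑ʳ k r e = refl

  vertex-slot : ∀ v → vertex (slot v) ≡ v
  vertex-slot v with splitAt k v in eq
  ... | inj₁ j = splitAt⁻¹-↑ˡ eq
  ... | inj₂ w with splitAt k w in eq′
  ...   | inj₁ j = trans (cong (k ↑ʳ_) (splitAt⁻¹-↑ˡ eq′)) (splitAt⁻¹-↑ʳ eq)
  ...   | inj₂ e = trans (cong (k ↑ʳ_) (splitAt⁻¹-↑ʳ eq′)) (splitAt⁻¹-↑ʳ eq)

  pairSum : (Vertex → ℕ) → Fin k → ℕ
  pairSum f j = f (vertex (pair true j)) + f (vertex (pair false j))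

  pairSum-sides : ∀ f j b → pairSum f j ≡ f (vertex (pair b j)) + f (vertex (pair (not b) j))
  pairSum-sides f j true  = refl
  pairSum-sides f j false = +-comm (f (vertex (pair true j))) (f (vertex (pair false j)))

  sum-by-slots : ∀ f → sum f ≡ sum (pairSum f) + sum (f ∘ vertex ∘ extra)
  sum-by-slots f = begin
    sum f                  ≡⟨ sum-↑ k f ⟩
    P + sum (f ∘ (k ↑ʳ_))  ≡⟨ cong (P +_) (sum-↑ k (f ∘ (k ↑ʳ_))) ⟩
    P + (P′ + E)           ≡⟨ +-assoc P P′ E ⟨
    P + P′ + E             ≡⟨ cong (_+ E) (∑-distrib-+ (f ∘ vertex ∘ pair true) (f ∘ vertex ∘ pair false)) ⟨
    sum (pairSum f) + E    ∎
    where
    open ≡-Reasoning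
    P  = sum (f ∘ vertex ∘ pair true)
    P′ = sum (f ∘ vertex ∘ pair false)
    E  = sum (f ∘ vertex ∘ extra)

  chosenWeight : (Vertex → ℕ) → (Fin k → Bool) → ℕ
  chosenWeight ω s = sum λ j → ω (vertex (pair (s j) j))

  chosenWeight-≤ : ∀ {W} {ω : Vertex → ℕ} → (∀ v → ω v ≤ W) → ∀ s → chosenWeight ω s ≤ k * W
  chosenWeight-≤ {ω = ω} ω≤W s = sum-≤-* {f = λ j → ω (vertex (pair (s j) j))} (λ j → ω≤W _)

module TwinGraph {k r : ℕ} (s s′ : Fin k → Bool) (j₀ : Fin k) (s≢s′ : s j₀ ≢ s′ j₀) where
  open PairedVertices k r

  -- X j and Y j are x_j and y_j; Z marks the isolated vertices.
  data Role : Set where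
    X Y : Fin k → Role
    Z   : Role

  sideRole : Bool → Bool → Bool → Fin k → Role
  sideRole σ b b′ j = if b xor b′ then (if σ xor b then Y j else X j) else Z

  sideRole-X : ∀ σ b b′ {i j} → sideRole σ b b′ i ≡ X j → i ≡ j × σ ≡ b × b ≢ b′
  sideRole-X true  true  false refl = refl , refl , λ ()
  sideRole-X false false true  refl = refl , refl , λ ()
  sideRole-X true  false true  ()
  sideRole-X false true  false ()
  sideRole-X _     true  true  ()
  sideRole-X _     false false ()

  sideRole-Y : ∀ σ b b′ {i j} → sideRole σ b b′ i ≡ Y j → i ≡ j × σ ≡ not b × b ≢ b′
  sideRole-Y false true  false refl = refl , refl , λ ()
  sideRole-Y true  false true  refl = refl , refl , λ ()
  sideRole-Y true  true  false ()
  sideRole-Y false false true  ()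
  sideRole-Y _     true  true  ()
  sideRole-Y _     false false ()

  sideRole-Z : ∀ σ b b′ {i} → sideRole σ b b′ i ≡ Z → b ≡ b′
  sideRole-Z _     true  true  _ = refl
  sideRole-Z _     false false _ = refl
  sideRole-Z true  true  false ()
  sideRole-Z false true  false ()
  sideRole-Z true  false true  ()
  sideRole-Z false false true  ()

  sideRole-same : ∀ σ b {j} → sideRole σ b b j ≡ Z
  sideRole-same σ true  = refl
  sideRole-same σ false = refl

  sideRole-chosen : ∀ b b′ {j} → b ≢ b′ → sideRole b b b′ j ≡ X j
  sideRole-chosen true  true  b≢b′ = ⊥-elim (b≢b′ refl)
  sideRole-chosen true  false _    = refl
  sideRole-chosen false true  _    = refl
  sideRole-chosen false false b≢b′ = ⊥-elim (b≢b′ refl)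

  sideRole-other : ∀ b b′ {j} → b ≢ b′ → sideRole (not b) b b′ j ≡ Y j
  sideRole-other true  true  b≢b′ = ⊥-elim (b≢b′ refl)
  sideRole-other true  false _    = refl
  sideRole-other false true  _    = refl
  sideRole-other false false b≢b′ = ⊥-elim (b≢b′ refl)

  slotRole : Slot → Role
  slotRole (pair σ j) = sideRole σ (s j) (s′ j) j
  slotRole (extra _)  = Z

  role : Vertex → Role
  role = slotRole ∘ slot

  role-vertex : ∀ x → role (vertex x) ≡ slotRole x
  role-vertex x = cong slotRole (slot-vertex x)

  Differ : Fin k → Set
  Differ j = s j ≢ s′ j

  xv yv : Fin k → Vertex
  xv j = vertex (pair (s j) j)
  yv j = vertex (pair (not (s j)) j)

  role-xv : ∀ {j} → Differ j → role (xv j) ≡ X j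
  role-xv {j} d = trans (role-vertex (pair (s j) j)) (sideRole-chosen (s j) (s′ j) d)

  role-yv : ∀ {j} → Differ j → role (yv j) ≡ Y j
  role-yv {j} d = trans (role-vertex (pair (not (s j)) j)) (sideRole-other (s j) (s′ j) d)

  role-shared : ∀ {j} → s j ≡ s′ j → ∀ σ → role (vertex (pair σ j)) ≡ Z
  role-shared {j} agree σ =
    trans (role-vertex (pair σ j)) (subst (λ b′ → sideRole σ (s j) b′ j ≡ Z) agree (sideRole-same σ (s j)))

  role-X : ∀ v {j} → role v ≡ X j → v ≡ xv j × Differ j
  role-X v h with slot v | vertex-slot v
  ... | pair σ i | v≡ with sideRole-X σ (s i) (s′ i) h
  ...   | refl , refl , d = sym v≡ , d
  role-X v () | extra _ | _

  role-Y : ∀ v {j} → role v ≡ Y j → v ≡ yv j × Differ j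
  role-Y v h with slot v | vertex-slot v
  ... | pair σ i | v≡ with sideRole-Y σ (s i) (s′ i) h
  ...   | refl , refl , d = sym v≡ , d
  role-Y v () | extra _ | _

  Link : Fin k → Fin k → Set
  Link i j = i ≡ j ⊎ i ≡ j₀ ⊎ j ≡ j₀

  AdjRole : Role → Role → Set
  AdjRole (X i) (Y j) = Link i j
  AdjRole (Y j) (X i) = Link i j
  AdjRole _     _     = ⊥

  AdjRole-sym : ∀ ρ τ → AdjRole ρ τ → AdjRole τ ρ
  AdjRole-sym (X i) (Y j) l = l
  AdjRole-sym (Y j) (X i) l = l

  AdjRole-irrefl : ∀ ρ → ¬ AdjRole ρ ρ
  AdjRole-irrefl (X i) ()
  AdjRole-irrefl (Y j) ()
  AdjRole-irrefl Z     ()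

  G : Graph (k + (k + r))
  G = record
    { Adj    = λ u v → AdjRole (role u) (role v)
    ; symm   = λ {u} {v} → AdjRole-sym (role u) (role v)
    ; irrefl = λ {u} → AdjRole-irrefl (role u)
    }

  xv-adj-yv : ∀ {i j} → Differ i → Differ j → Link i j → Adj G (xv i) (yv j)
  xv-adj-yv dᵢ dⱼ l = subst₂ AdjRole (sym (role-xv dᵢ)) (sym (role-yv dⱼ)) l

  depthX : Fin k → ℕ
  depthX j with j ≟ᶠ j₀
  ... | yes _ = 1
  ... | no  _ = 3

  depthX-j₀ : depthX j₀ ≡ 1
  depthX-j₀ with j₀ ≟ᶠ j₀
  ... | yes _     = refl
  ... | no  j₀≢j₀ = ⊥-elim (j₀≢j₀ refl)

  depthRole : Role → ℕ
  depthRole (X j) = depthX j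
  depthRole (Y j) = suc (depthX j)
  depthRole Z     = 1

  depthRole-≤4 : ∀ ρ → depthRole ρ ≤ 4
  depthRole-≤4 (X j) with j ≟ᶠ j₀
  ... | yes _ = s≤s z≤n
  ... | no  _ = s≤s (s≤s (s≤s z≤n))
  depthRole-≤4 (Y j) with j ≟ᶠ j₀
  ... | yes _ = s≤s (s≤s z≤n)
  ... | no  _ = ≤-refl
  depthRole-≤4 Z = s≤s z≤n

  parentRole : Role → Maybe Vertex
  parentRole (X j) with j ≟ᶠ j₀
  ... | yes _ = nothing
  ... | no  _ = just (yv j₀)
  parentRole (Y j) = just (xv j)
  parentRole Z     = nothing

  depthRole-root : ∀ ρ → parentRole ρ ≡ nothing → depthRole ρ ≡ 1
  depthRole-root (X j) h with j ≟ᶠ j₀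
  depthRole-root (X j) h  | yes _ = refl
  depthRole-root (X j) () | no  _
  depthRole-root (Y j) ()
  depthRole-root Z     _ = refl

  depthRole-parent : ∀ v u → parentRole (role v) ≡ just u → depthRole (role v) ≡ suc (depthRole (role u))
  depthRole-parent v u h with role v in ρ≡
  depthRole-parent v u h    | X j with j ≟ᶠ j₀
  depthRole-parent v u ()   | X j | yes _
  depthRole-parent v u refl | X j | no _ =
    cong suc (sym (trans (cong depthRole (role-yv s≢s′)) (cong suc depthX-j₀)))
  depthRole-parent v u refl | Y j = cong suc (sym (cong depthRole (role-xv (proj₂ (role-Y v ρ≡)))))
  depthRole-parent v u ()   | Z

  F : RootedForest (k + (k + r))
  F = record
    { parent       = parentRole ∘ role
    ; depth        = depthRole ∘ role
    ; depth-root   = depthRole-root ∘ role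
    ; depth-parent = depthRole-parent
    }

  parent-yv : ∀ {j} → Differ j → parent F (yv j) ≡ just (xv j)
  parent-yv d = cong parentRole (role-yv d)

  parent-xv : ∀ {j} → Differ j → j ≢ j₀ → parent F (xv j) ≡ just (yv j₀)
  parent-xv {j} d j≢j₀ rewrite role-xv d with j ≟ᶠ j₀
  ... | yes j≡j₀ = ⊥-elim (j≢j₀ j≡j₀)
  ... | no  _    = refl

  edge-ancestor : ∀ {i j} → Differ i → Differ j → Link i j →
                  Ancestor F (xv i) (yv j) ⊎ Ancestor F (yv j) (xv i)
  edge-ancestor dᵢ dⱼ (inj₁ refl) = inj₁ (anc-parent (parent-yv dⱼ))
  edge-ancestor {j = j} dᵢ dⱼ (inj₂ (inj₁ refl)) with j ≟ᶠ j₀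
  ... | yes refl = inj₁ (anc-parent (parent-yv dⱼ))
  ... | no  j≢j₀ = inj₁ (anc-step (parent-yv dⱼ) (anc-step (parent-xv dⱼ j≢j₀) (anc-parent (parent-yv dᵢ))))
  edge-ancestor {i = i} dᵢ dⱼ (inj₂ (inj₂ refl)) with i ≟ᶠ j₀
  ... | yes refl = inj₁ (anc-parent (parent-yv dᵢ))
  ... | no  i≢j₀ = inj₂ (anc-parent (parent-xv dᵢ i≢j₀))

  adjacent-ancestor : ∀ u v → Adj G u v → Ancestor F u v ⊎ Ancestor F v u
  adjacent-ancestor u v adj with role u in ρᵤ | role v in ρᵥ
  ... | X i | Y j with role-X u ρᵤ | role-Y v ρᵥ
  ...   | refl , dᵢ | refl , dⱼ = edge-ancestor dᵢ dⱼ adj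
  adjacent-ancestor u v adj | Y j | X i with role-Y u ρᵤ | role-X v ρᵥ
  ...   | refl , dⱼ | refl , dᵢ = swap (edge-ancestor dᵢ dⱼ adj)

  treedepth≤4 : TreedepthAtMost G 4
  treedepth≤4 = F , depthRole-≤4 ∘ role , adjacent-ancestor

  inA inB : Role → Bool
  inA (X _) = true
  inA (Y _) = false
  inA Z     = true
  inB (X _) = false
  inB (Y _) = true
  inB Z     = true

  a b : Vertex → Bool
  a = inA ∘ role
  b = inB ∘ role

  independent-a : Independentᵇ G a
  independent-a u v au av adj with role u | role v | au | av | adj
  ... | X _ | Y _ | _  | () | _
  ... | Y _ | X _ | () | _  | _

  independent-b : Independentᵇ G b
  independent-b u v bu bv adj with role u | role v | bu | bv | adj
  ... | X _ | Y _ | () | _  | _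
  ... | Y _ | X _ | _  | () | _

  pairSum-a-shared : ∀ {j} → s j ≡ s′ j → pairSum (𝟙 ∘ a) j ≡ 2
  pairSum-a-shared agree =
    cong₂ (λ ρ τ → 𝟙 (inA ρ) + 𝟙 (inA τ)) (role-shared agree true) (role-shared agree false)

  pairSum-a-differ : ∀ {j} → Differ j → pairSum (𝟙 ∘ a) j ≡ 1
  pairSum-a-differ {j} d = trans (pairSum-sides (𝟙 ∘ a) j (s j))
                                 (cong₂ (λ ρ τ → 𝟙 (inA ρ) + 𝟙 (inA τ)) (role-xv d) (role-yv d))

  a-extra : ∀ e → a (vertex (extra e)) ≡ true
  a-extra e = cong inA (role-vertex (extra e))

  b-extra : ∀ e → b (vertex (extra e)) ≡ true
  b-extra e = cong inB (role-vertex (extra e))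

  pair-bound : ∀ {c} → Independentᵇ G c → ∀ j → pairSum (𝟙 ∘ c) j ≤ pairSum (𝟙 ∘ a) j
  pair-bound {c} ind j with s j ≟ᵇ s′ j
  ... | yes agree = ≤-trans (+-mono-≤ (𝟙≤1 (c (vertex (pair true j)))) (𝟙≤1 (c (vertex (pair false j)))))
                            (≤-reflexive (sym (pairSum-a-shared agree)))
  ... | no  d     = begin
    pairSum (𝟙 ∘ c) j               ≡⟨ pairSum-sides (𝟙 ∘ c) j (s j) ⟩
    𝟙 (c (xv j)) + 𝟙 (c (yv j))     ≤⟨ 𝟙+𝟙≤1 (c (xv j)) (c (yv j)) not-both ⟩
    1                               ≡⟨ pairSum-a-differ d ⟨
    pairSum (𝟙 ∘ a) j               ∎
    where
    open ≤-Reasoning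
    not-both : c (xv j) ≡ true → c (yv j) ≡ true → ⊥
    not-both cx cy = ind _ _ cx cy (xv-adj-yv d d (inj₁ refl))

  extra-bound : ∀ (c : Vertex → Bool) e → 𝟙 (c (vertex (extra e))) ≤ 𝟙 (a (vertex (extra e)))
  extra-bound c e = ≤-trans (𝟙≤1 (c (vertex (extra e)))) (≤-reflexive (cong 𝟙 (sym (a-extra e))))

  ∣∣ᵇ-by-slots : ∀ c → ∣ c ∣ᵇ ≡ sum (pairSum (𝟙 ∘ c)) + sum (𝟙 ∘ c ∘ vertex ∘ extra)
  ∣∣ᵇ-by-slots c = sum-by-slots (𝟙 ∘ c)

  ∣∣ᵇ≤∣a∣ᵇ : ∀ c → Independentᵇ G c → ∣ c ∣ᵇ ≤ ∣ a ∣ᵇ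
  ∣∣ᵇ≤∣a∣ᵇ c ind = begin
    ∣ c ∣ᵇ                                                   ≡⟨ ∣∣ᵇ-by-slots c ⟩
    sum (pairSum (𝟙 ∘ c)) + sum (𝟙 ∘ c ∘ vertex ∘ extra)
      ≤⟨ +-mono-≤ (sum-mono-≤ (pair-bound ind)) (sum-mono-≤ {f = 𝟙 ∘ c ∘ vertex ∘ extra} (extra-bound c)) ⟩
    sum (pairSum (𝟙 ∘ a)) + sum (𝟙 ∘ a ∘ vertex ∘ extra)     ≡⟨ ∣∣ᵇ-by-slots a ⟨
    ∣ a ∣ᵇ                                                   ∎
    where open ≤-Reasoning

  module LargeIndependent (c : Vertex → Bool) (ind : Independentᵇ G c) (large : ∣ a ∣ᵇ ≤ ∣ c ∣ᵇ) where

    tight : sum (pairSum (𝟙 ∘ c)) ≡ sum (pairSum (𝟙 ∘ a)) ×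
            sum (𝟙 ∘ c ∘ vertex ∘ extra) ≡ sum (𝟙 ∘ a ∘ vertex ∘ extra)
    tight = +-tight (sum-mono-≤ (pair-bound ind)) (sum-mono-≤ {f = 𝟙 ∘ c ∘ vertex ∘ extra} (extra-bound c))
                    (subst₂ _≤_ (∣∣ᵇ-by-slots a) (∣∣ᵇ-by-slots c) large)

    pair-tight : ∀ j → pairSum (𝟙 ∘ c) j ≡ pairSum (𝟙 ∘ a) j
    pair-tight = sum-tight (pair-bound ind) (≤-reflexive (sym (proj₁ tight)))

    extra-in : ∀ e → c (vertex (extra e)) ≡ true
    extra-in e = 𝟙≡1 (c (vertex (extra e)))
      (trans (sum-tight (extra-bound c) (≤-reflexive (sym (proj₂ tight))) e) (cong 𝟙 (a-extra e)))

    shared-in : ∀ x → slotRole x ≡ Z → c (vertex x) ≡ true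
    shared-in (pair σ j) ρ≡Z with 𝟙+𝟙≡2 (c (vertex (pair true j))) (c (vertex (pair false j)))
                                         (trans (pair-tight j) (pairSum-a-shared (sideRole-Z σ (s j) (s′ j) ρ≡Z)))
    shared-in (pair true  j) _ | left , _     = left
    shared-in (pair false j) _ | _    , right = right
    shared-in (extra e)      _ = extra-in e

    exactly-one : ∀ {j} → Differ j → c (xv j) ≡ not (c (yv j))
    exactly-one {j} d = 𝟙+𝟙≡1 (c (xv j)) (c (yv j))
      (trans (sym (pairSum-sides (𝟙 ∘ c) j (s j))) (trans (pair-tight j) (pairSum-a-differ d)))

    determined-by-role : (R : Role → Bool) → R Z ≡ true →
                         (∀ {j} → Differ j → c (xv j) ≡ R (X j)) → (∀ {j} → Differ j → c (yv j) ≡ R (Y j)) →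
                         ∀ v → c v ≡ R (role v)
    determined-by-role R RZ onX onY v with role v in ρ≡
    ... | X j with role-X v ρ≡
    ...   | refl , d = onX d
    determined-by-role R RZ onX onY v | Y j with role-Y v ρ≡
    ...   | refl , d = onY d
    determined-by-role R RZ onX onY v | Z =
      trans (cong c (sym (vertex-slot v))) (trans (shared-in (slot v) ρ≡) (sym RZ))

    c≗a⊎c≗b : (∀ v → c v ≡ a v) ⊎ (∀ v → c v ≡ b v)
    c≗a⊎c≗b with c (xv j₀) in cx₀
    ... | true  = inj₁ (determined-by-role inA refl x-in y-out)
      where
      y-out : ∀ {j} → Differ j → c (yv j) ≡ false
      y-out d = ¬-not λ cy → ind _ _ cx₀ cy (xv-adj-yv s≢s′ d (inj₂ (inj₁ refl)))
      x-in : ∀ {j} → Differ j → c (xv j) ≡ true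
      x-in d = trans (exactly-one d) (cong not (y-out d))
    ... | false = inj₂ (determined-by-role inB refl x-out y-in)
      where
      cy₀ : c (yv j₀) ≡ true
      cy₀ = not-injective (trans (sym (exactly-one s≢s′)) cx₀)
      x-out : ∀ {j} → Differ j → c (xv j) ≡ false
      x-out d = ¬-not λ cx → ind _ _ cx cy₀ (xv-adj-yv d s≢s′ (inj₂ (inj₂ refl)))
      y-in : ∀ {j} → Differ j → c (yv j) ≡ true
      y-in d = not-injective (trans (sym (exactly-one d)) (x-out d))

  mask-at : ∀ ω (R : Role → Bool) {v ρ} → role v ≡ ρ → mask ω (R ∘ role) v ≡ (if R ρ then ω v else 0)
  mask-at ω R {v} = cong (λ ρ → if R ρ then ω v else 0)

  -- Each selection is added to the other side, so that no subtraction occurs.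
  pair-balance : ∀ ω j → pairSum (mask ω a) j + ω (vertex (pair (s′ j) j)) ≡
                         pairSum (mask ω b) j + ω (vertex (pair (s j) j))
  pair-balance ω j with s j ≟ᵇ s′ j
  ... | yes agree =
    cong₂ _+_ (cong₂ _+_ (same-mask true) (same-mask false)) (cong (λ b′ → ω (vertex (pair b′ j))) (sym agree))
    where
    same-mask : ∀ σ → mask ω a (vertex (pair σ j)) ≡ mask ω b (vertex (pair σ j))
    same-mask σ = trans (mask-at ω inA (role-shared agree σ)) (sym (mask-at ω inB (role-shared agree σ)))
  ... | no d = begin
    pairSum (mask ω a) j + ω (vertex (pair (s′ j) j))
      ≡⟨ cong₂ _+_ (pairSum-sides (mask ω a) j (s j)) (cong (λ b′ → ω (vertex (pair b′ j))) s′≡¬s) ⟩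
    mask ω a (xv j) + mask ω a (yv j) + ω (yv j)
      ≡⟨ cong₂ (λ p q → p + q + ω (yv j)) (mask-at ω inA (role-xv d)) (mask-at ω inA (role-yv d)) ⟩
    ω (xv j) + 0 + ω (yv j)
      ≡⟨ trans (cong (_+ ω (yv j)) (+-identityʳ (ω (xv j)))) (+-comm (ω (xv j)) (ω (yv j))) ⟩
    0 + ω (yv j) + ω (xv j)
      ≡⟨ cong₂ (λ p q → p + q + ω (xv j)) (mask-at ω inB (role-xv d)) (mask-at ω inB (role-yv d)) ⟨
    mask ω b (xv j) + mask ω b (yv j) + ω (xv j)
      ≡⟨ cong (_+ ω (xv j)) (pairSum-sides (mask ω b) j (s j)) ⟨
    pairSum (mask ω b) j + ω (vertex (pair (s j) j))
      ∎
    where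
    open ≡-Reasoning
    s′≡¬s : s′ j ≡ not (s j)
    s′≡¬s = ¬-not (d ∘ sym)

  weight-balance : ∀ ω → weightᵇ ω a + chosenWeight ω s′ ≡ weightᵇ ω b + chosenWeight ω s
  weight-balance ω = begin
    weightᵇ ω a + C′   ≡⟨ cong (_+ C′) (sum-by-slots (mask ω a)) ⟩
    Pa + Ea + C′       ≡⟨ xy∙z≈xz∙y Pa Ea C′ ⟩
    Pa + C′ + Ea       ≡⟨ cong₂ _+_ pairs extras ⟩
    Pb + C + Eb        ≡⟨ xy∙z≈xz∙y Pb C Eb ⟩
    Pb + Eb + C        ≡⟨ cong (_+ C) (sum-by-slots (mask ω b)) ⟨
    weightᵇ ω b + C    ∎
    where
    open ≡-Reasoning
    C  = chosenWeight ω s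
    C′ = chosenWeight ω s′
    Pa = sum (pairSum (mask ω a))
    Pb = sum (pairSum (mask ω b))
    Ea = sum (mask ω a ∘ vertex ∘ extra)
    Eb = sum (mask ω b ∘ vertex ∘ extra)
    pairs : Pa + C′ ≡ Pb + C
    pairs = begin
      Pa + C′                                                        ≡⟨ ∑-distrib-+ (pairSum (mask ω a)) _ ⟨
      sum (λ j → pairSum (mask ω a) j + ω (vertex (pair (s′ j) j)))  ≡⟨ sum-cong-≗ (pair-balance ω) ⟩
      sum (λ j → pairSum (mask ω b) j + ω (vertex (pair (s j) j)))   ≡⟨ ∑-distrib-+ (pairSum (mask ω b)) _ ⟩
      Pb + C                                                         ∎
    extras : Ea ≡ Eb
    extras = sum-cong-≗ λ e → cong (if_then ω (vertex (extra e)) else 0) (trans (a-extra e) (sym (b-extra e)))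

  equal-weights : ∀ ω → chosenWeight ω s ≡ chosenWeight ω s′ → weightᵇ ω a ≡ weightᵇ ω b
  equal-weights ω balanced =
    +-cancelʳ-≡ (chosenWeight ω s′) _ _ (trans (weight-balance ω) (cong (weightᵇ ω b +_) balanced))

  ∣a∣ᵇ≡∣b∣ᵇ : ∣ a ∣ᵇ ≡ ∣ b ∣ᵇ
  ∣a∣ᵇ≡∣b∣ᵇ = equal-weights (λ _ → 1) refl

  twins : (ω : Fin t → Vertex → ℕ) → (∀ i → chosenWeight (ω i) s ≡ chosenWeight (ω i) s′) → EqualWeightTwins ω
  twins ω balanced =
    G , treedepth≤4 , tabulate a , tabulate b , A≢B , max-a , max-b , unique ,
    λ i → trans (weight-tabulate (ω i) a)
                (trans (equal-weights (ω i) (balanced i)) (sym (weight-tabulate (ω i) b)))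
    where
    max-a : MaximumIndependent G (tabulate a)
    max-a = maximum-tabulate {G = G} independent-a ∣∣ᵇ≤∣a∣ᵇ
    max-b : MaximumIndependent G (tabulate b)
    max-b = maximum-tabulate {G = G} independent-b λ c ind → subst (∣ c ∣ᵇ ≤_) ∣a∣ᵇ≡∣b∣ᵇ (∣∣ᵇ≤∣a∣ᵇ c ind)
    A≢B : tabulate a ≢ tabulate b
    A≢B A≡B with subst (λ ρ → inA ρ ≡ inB ρ) (role-xv s≢s′)
                   (trans (sym (lookup∘tabulate a (xv j₀)))
                          (trans (cong (λ C → lookup C (xv j₀)) A≡B) (lookup∘tabulate b (xv j₀))))
    ... | ()
    unique : ∀ C → MaximumIndependent G C → C ≡ tabulate a ⊎ C ≡ tabulate b
    unique C (indC , maxC) =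
      ⊎-map ≗-tabulate ≗-tabulate (LargeIndependent.c≗a⊎c≗b (lookup C) (independent-lookup {G = G} {C} indC) large)
      where
      large : ∣ a ∣ᵇ ≤ ∣ lookup C ∣ᵇ
      large = subst₂ _≤_ (∣tabulate∣ a) (∣∣≡∣lookup∣ᵇ C) (maxC (tabulate a) (proj₁ max-a))

equal-weight-twins : ∀ k → k + k ≤ n → (ω : Fin t → Fin n → ℕ) → (∀ i v → ω i v ≤ W) →
                     suc (k * W) ^ t < 2 ^ k → EqualWeightTwins ω
equal-weight-twins {n} {t} {W} k 2k≤n = on-layout (n ∸ (k + k)) (trans (sym (+-assoc k k _)) (m+[n∸m]≡n 2k≤n))
  where
  on-layout : ∀ r → k + (k + r) ≡ n → (ω : Fin t → Fin n → ℕ) → (∀ i v → ω i v ≤ W) →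
              suc (k * W) ^ t < 2 ^ k → EqualWeightTwins ω
  on-layout r refl ω ω≤W room
    with selectors-with-equal-sums (λ s i → chosenWeight (ω i) s) (λ s i → chosenWeight-≤ (ω≤W i) s) room
    where open PairedVertices k r
  ... | s , s′ , (j₀ , s≢s′) , balanced = TwinGraph.twins s s′ j₀ s≢s′ ω balanced

lemma7p2 : Σ ℕ λ p → Σ ℕ λ q → 0 < p × 0 < q × Σ ℕ λ N₀ →
    ∀ n W → N₀ ≤ n → N₀ ≤ W →
    ∀ t → (ω : Fin t → WeightAssignment n W) →
    q * t * ⌈log₂ (n * W) ⌉ ≤ p * n →
    Σ (Graph n) λ G → TreedepthAtMost G 4 ×
    Σ (Subset n) λ A → Σ (Subset n) λ B →
    A ≢ B × MaximumIndependent G A × MaximumIndependent G B ×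
    (∀ C → MaximumIndependent G C → C ≡ A ⊎ C ≡ B) ×
    (∀ i → weight (proj₁ (ω i)) A ≡ weight (proj₁ (ω i)) B)
lemma7p2 = 1 , 8 , z<s , z<s , 2 , λ n W 2≤n 2≤W t ω small →
  equal-weight-twins ⌊ n /2⌋ (⌊n/2⌋+⌊n/2⌋≤n n) (proj₁ ∘ ω) (λ i v → proj₂ (proj₂ (ω i) v))
                     (weight-profiles<2^⌊n/2⌋ {t = t} 2≤n 2≤W small)
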